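{- Let $p$ be an odd prime, $e\ge1$, and let $\mathcal M$ be an orientably-regular embedding of $K_{p[p^e]}$ with $G=\mathrm{Aut}^+(\mathcal M)$, and let $H\trianglelefteq G$ be the subgroup of automorphisms preserving each of the $p$ parts setwise. Suppose $H=\langle x,z\mid x^{p^e}=z^{p^e}=1,\ z^x=z^q\rangle$ where $q=1+p^f$ with $f\in\{1,\dots,e\}$. Then $N=\langle x^{p^{e-f}},z\rangle$ is a normal subgroup of $G$.
   Context: $K_{p[p^e]}$ is the complete multipartite graph with $p$ parts of $p^e$ vertices each. An orientably-regular embedding of a graph is a 2-cell embedding into an orientable surface whose group $\mathrm{Aut}^+(\mathcal M)$ of orientation-preserving automorphisms acts regularly on the arcs. $z^x=x^{ -1}zx$. -}

module Defs where

open import Data.Nat using (ℕ; zero; suc; _<_)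
open import Data.Fin using (Fin)
open import Data.Product using (Σ; ∃; ∃-syntax; _×_; _,_; proj₁; proj₂)
open import Relation.Binary.PropositionalEquality using (_≡_; _≢_)

iter : {A : Set} → (A → A) → ℕ → A → A
iter f zero    a = a
iter f (suc k) a = f (iter f k a)

-- Complete multipartite graph K_{n[m]}: vertices (part , index)
Vtx : ℕ → ℕ → Set
Vtx n m = Fin n × Fin m

Adj : {n m : ℕ} → Vtx n m → Vtx n m → Set
Adj u v = proj₁ u ≢ proj₁ v

-- An embedding of K_{n[m]} into an orientable surface, given by its rotation
-- system: ρ u v is the neighbour of u following v in the cyclic order at u.
-- (Arcs are ordered pairs (u , v) of adjacent vertices.)
record Embedding (n m : ℕ) : Set where
  field
    ρ     : Vtx n m → Vtx n m → Vtx n m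
    ρ-adj : ∀ u v → Adj u v → Adj u (ρ u v)
    ρ-inj : ∀ u v w → Adj u v → Adj u w → ρ u v ≡ ρ u w → v ≡ w
    ρ-cyc : ∀ u v w → Adj u v → Adj u w → ∃[ k ] (iter (ρ u) k v ≡ w)
open Embedding public

-- Orientation-preserving automorphism of the map: a graph automorphism
-- commuting with the rotation system.
record Aut⁺ {n m : ℕ} (M : Embedding n m) : Set where
  field
    fwd     : Vtx n m → Vtx n m
    bwd     : Vtx n m → Vtx n m
    bwd-fwd : ∀ v → bwd (fwd v) ≡ v
    fwd-bwd : ∀ v → fwd (bwd v) ≡ v
    adj→    : ∀ u v → Adj u v → Adj (fwd u) (fwd v)
    adj←    : ∀ u v → Adj (fwd u) (fwd v) → Adj u v
    rot     : ∀ u v → Adj u v → fwd (ρ M u v) ≡ ρ M (fwd u) (fwd v)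
open Aut⁺ public

-- Aut⁺(M) acts regularly on arcs
record OrientablyRegular {n m : ℕ} (M : Embedding n m) : Set where
  field
    transitive : ∀ u v u' v' → Adj u v → Adj u' v' →
                 Σ (Aut⁺ M) λ σ → (fwd σ u ≡ u') × (fwd σ v ≡ v')
    free       : ∀ (σ τ : Aut⁺ M) u v → Adj u v →
                 fwd σ u ≡ fwd τ u → fwd σ v ≡ fwd τ v →
                 ∀ w → fwd σ w ≡ fwd τ w

PartPreserving : {n m : ℕ} {M : Embedding n m} → Aut⁺ M → Set
PartPreserving {n} {m} σ = ∀ (v : Vtx n m) → proj₁ (fwd σ v) ≡ proj₁ v

-- H = ⟨x , z | x^r = z^r = 1 , z^x = z^q⟩ (with group product g·h = g ∘ h):
-- x, z ∈ H satisfy the relations and the map (i , j) ↦ x^i z^j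
-- (0 ≤ i , j < r) from the presented group (of order r², normal form x^i z^j)
-- onto H is a bijection.
HasPresentation : {n m : ℕ} (M : Embedding n m) (r q : ℕ) (x z : Aut⁺ M) → Set
HasPresentation {n} {m} M r q x z =
  PartPreserving x × PartPreserving z ×
  (∀ v → iter (fwd x) r v ≡ v) ×
  (∀ v → iter (fwd z) r v ≡ v) ×
  (∀ v → bwd x (fwd z (fwd x v)) ≡ iter (fwd z) q v) ×
  (∀ (h : Aut⁺ M) → PartPreserving h →
     ∃[ i ] ∃[ j ] (i < r × j < r ×
       (∀ v → fwd h v ≡ iter (fwd x) i (iter (fwd z) j v)))) ×
  (∀ i j i' j' → i < r → j < r → i' < r → j' < r →
     (∀ v → iter (fwd x) i (iter (fwd z) j v) ≡ iter (fwd x) i' (iter (fwd z) j' v)) →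
     (i ≡ i') × (j ≡ j'))

data ⟨_,_⟩ {A : Set} (a b : A → A) : (A → A) → Set where
  genˡ : ⟨ a , b ⟩ a
  genʳ : ⟨ a , b ⟩ b
  one  : ⟨ a , b ⟩ (λ v → v)
  mul  : ∀ {f g} → ⟨ a , b ⟩ f → ⟨ a , b ⟩ g → ⟨ a , b ⟩ (λ v → f (g v))
  inv  : ∀ {f g} → ⟨ a , b ⟩ f → (∀ v → g (f v) ≡ v) → (∀ v → f (g v) ≡ v) → ⟨ a , b ⟩ g
  ext  : ∀ {f g} → ⟨ a , b ⟩ f → (∀ v → f v ≡ g v) → ⟨ a , b ⟩ g

NormalIn : {n m : ℕ} (M : Embedding n m) → (Vtx n m → Vtx n m) → (Vtx n m → Vtx n m) → Set
NormalIn M a b = ∀ (g : Aut⁺ M) f → ⟨ a , b ⟩ f → ⟨ a , b ⟩ (λ v → bwd g (f (fwd g v)))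

-- Write r = p^e, q = 1 + d with d = p^f, and k = p^(e-f), so that r = d·k.
-- Since H (the part-preserving automorphisms) is normal in G, for every g ∈ G
-- the conjugates x^g and z^g lie in H and so have normal forms
-- x^g = x^i' z^j' and z^g = x^i z^j.  Then
--   * (x^k)^g = (x^g)^k = x^(k·i') z^m lies in N, and
--   * conjugating the relation z^x = z^q by g gives z^g x^g = x^g (z^g)^q;
--     comparing x-exponents of the normal forms of both sides yields
--     i + i' ≡ i' + q·i (mod r), i.e. d·i ≡ 0 (mod d·k), so k ∣ i and
--     z^g = x^i z^j lies in N.
-- Finally a subgroup whose generators have all their conjugates inside it is
-- closed under conjugation.

module Submission where

open import Defs
open import Data.Nat using (ℕ; zero; suc; _+_; _*_; _∸_; _^_; _≤_; _<_; NonZero; _/_; _%_)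
open import Data.Nat.Properties
open import Data.Nat.DivMod using (m≡m%n+[m/n]*n; m%n<n)
open import Data.Nat.Divisibility using (_∣_; divides; ∣m+n∣m⇒∣n; *-cancelˡ-∣)
open import Data.Nat.Primality using (Prime; prime⇒nonZero)
open import Data.Fin using () renaming (_≟_ to _≟ᶠ_)
open import Data.Product using (∃-syntax; _×_; _,_; proj₁; proj₂)
open import Data.Empty using (⊥-elim)
open import Relation.Nullary using (yes; no)
open import Relation.Binary.PropositionalEquality

module Iteration {A : Set} where

  iter-+ : ∀ (f : A → A) m n v → iter f (m + n) v ≡ iter f m (iter f n v)
  iter-+ f zero    n v = refl
  iter-+ f (suc m) n v = cong f (iter-+ f m n v)

  iter-* : ∀ (f : A → A) m n v → iter f (n * m) v ≡ iter (iter f m) n v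
  iter-* f m zero    v = refl
  iter-* f m (suc n) v =
    trans (iter-+ f m (n * m) v) (cong (iter f m) (iter-* f m n v))

  iter-cong : ∀ {f g : A → A} → (∀ v → f v ≡ g v) → ∀ n v → iter f n v ≡ iter g n v
  iter-cong f≗g zero    v = refl
  iter-cong {g = g} f≗g (suc n) v = trans (f≗g _) (cong g (iter-cong f≗g n v))

  iter-id : ∀ {f : A → A} → (∀ v → f v ≡ v) → ∀ n v → iter f n v ≡ v
  iter-id f≗id zero    v = refl
  iter-id f≗id (suc n) v = trans (f≗id _) (iter-id f≗id n v)

  iter-mod : ∀ (f : A → A) r .{{_ : NonZero r}} → (∀ v → iter f r v ≡ v) →
             ∀ n v → iter f n v ≡ iter f (n % r) v
  iter-mod f r fʳ≗id n v = begin
    iter f n v                                  ≡⟨ cong (λ t → iter f t v) (m≡m%n+[m/n]*n n r) ⟩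
    iter f (n % r + n / r * r) v                ≡⟨ iter-+ f (n % r) _ v ⟩
    iter f (n % r) (iter f (n / r * r) v)       ≡⟨ cong (iter f (n % r)) (iter-* f r (n / r) v) ⟩
    iter f (n % r) (iter (iter f r) (n / r) v)  ≡⟨ cong (iter f (n % r)) (iter-id fʳ≗id (n / r) v) ⟩
    iter f (n % r) v                            ∎
    where open ≡-Reasoning

  iter-conj : ∀ (g g⁻¹ f : A → A) → (∀ v → g⁻¹ (g v) ≡ v) → (∀ v → g (g⁻¹ v) ≡ v) →
              ∀ n v → g⁻¹ (iter f n (g v)) ≡ iter (λ w → g⁻¹ (f (g w))) n v
  iter-conj g g⁻¹ f left right zero    v = left v
  iter-conj g g⁻¹ f left right (suc n) v =
    trans (cong (λ w → g⁻¹ (f w)) (sym (right _)))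
          (cong (λ w → g⁻¹ (f (g w))) (iter-conj g g⁻¹ f left right n v))

open Iteration

module Metacyclic {A : Set} (X Z : A → A) (c : ℕ)
                  (zx≗xzᶜ : ∀ v → Z (X v) ≡ X (iter Z c v)) where

  nf : ℕ → ℕ → A → A
  nf i j v = iter X i (iter Z j v)

  zʲx : ∀ j v → iter Z j (X v) ≡ X (iter Z (j * c) v)
  zʲx zero    v = refl
  zʲx (suc j) v = trans (cong Z (zʲx j v))
    (trans (zx≗xzᶜ _) (cong X (sym (iter-+ Z c (j * c) v))))

  zʲxⁱ : ∀ i j v → iter Z j (iter X i v) ≡ nf i (j * c ^ i) v
  zʲxⁱ zero    j v = cong (λ t → iter Z t v) (sym (*-identityʳ j))
  zʲxⁱ (suc i) j v = trans (zʲx j (iter X i v)) (cong X (trans (zʲxⁱ i (j * c) v)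
    (cong (λ t → nf i t v) (*-assoc j c (c ^ i)))))

  nf-mul : ∀ i j i' j' v → nf i j (nf i' j' v) ≡ nf (i + i') (j * c ^ i' + j') v
  nf-mul i j i' j' v =
    trans (cong (iter X i) (zʲxⁱ i' j (iter Z j' v)))
      (trans (sym (iter-+ X i i' _)) (cong (iter X (i + i')) (sym (iter-+ Z (j * c ^ i') j' v))))

  nf-pow : ∀ i j n → ∃[ m ] (∀ v → iter (nf i j) n v ≡ nf (n * i) m v)
  nf-pow i j zero    = 0 , λ v → refl
  nf-pow i j (suc n) with nf-pow i j n
  ... | m , powⁿ = j * c ^ (n * i) + m , λ v →
    trans (cong (nf i j) (powⁿ v)) (nf-mul i j (n * i) m v)

module Generated {A : Set} {a b : A → A} where

  pow-mem : ∀ {f} → ⟨ a , b ⟩ f → ∀ n → ⟨ a , b ⟩ (iter f n)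
  pow-mem f∈ zero    = one
  pow-mem f∈ (suc n) = mul f∈ (pow-mem f∈ n)

  conj-closed : (g g⁻¹ : A → A) → (∀ v → g⁻¹ (g v) ≡ v) → (∀ v → g (g⁻¹ v) ≡ v) →
                ⟨ a , b ⟩ (λ v → g⁻¹ (a (g v))) → ⟨ a , b ⟩ (λ v → g⁻¹ (b (g v))) →
                ∀ {f} → ⟨ a , b ⟩ f → ⟨ a , b ⟩ (λ v → g⁻¹ (f (g v)))
  conj-closed g g⁻¹ left right aᵍ bᵍ = closed
    where
    closed : ∀ {f} → ⟨ a , b ⟩ f → ⟨ a , b ⟩ (λ v → g⁻¹ (f (g v)))
    closed genˡ = aᵍ
    closed genʳ = bᵍ
    closed one  = ext one (λ v → sym (left v))
    closed (mul {f} {h} f∈ h∈) =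
      ext (mul (closed f∈) (closed h∈)) (λ v → cong (λ w → g⁻¹ (f w)) (right (h (g v))))
    closed (inv {f} {h} f∈ hf≗id fh≗id) = inv (closed f∈)
      (λ v → trans (cong (λ w → g⁻¹ (h w)) (right _)) (trans (cong g⁻¹ (hf≗id (g v))) (left v)))
      (λ v → trans (cong (λ w → g⁻¹ (f w)) (right _)) (trans (cong g⁻¹ (fh≗id (g v))) (left v)))
    closed (ext f∈ f≗h) = ext (closed f∈) (λ v → cong g⁻¹ (f≗h (g v)))

open Generated

module AutGroup {n m : ℕ} {M : Embedding n m} where

  inverse : Aut⁺ M → Aut⁺ M
  inverse σ = record
    { fwd = bwd σ ; bwd = fwd σ ; bwd-fwd = fwd-bwd σ ; fwd-bwd = bwd-fwd σ
    ; adj→ = adj-bwd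
    ; adj← = λ u v a → subst₂ Adj (fwd-bwd σ u) (fwd-bwd σ v) (adj→ σ _ _ a)
    ; rot = λ u v a → begin
        bwd σ (ρ M u v)
          ≡⟨ cong₂ (λ s t → bwd σ (ρ M s t)) (sym (fwd-bwd σ u)) (sym (fwd-bwd σ v)) ⟩
        bwd σ (ρ M (fwd σ (bwd σ u)) (fwd σ (bwd σ v)))
          ≡⟨ cong (bwd σ) (sym (rot σ _ _ (adj-bwd u v a))) ⟩
        bwd σ (fwd σ (ρ M (bwd σ u) (bwd σ v)))
          ≡⟨ bwd-fwd σ _ ⟩
        ρ M (bwd σ u) (bwd σ v)
          ∎
    }
    where
    open ≡-Reasoning
    adj-bwd : ∀ u v → Adj u v → Adj (bwd σ u) (bwd σ v)
    adj-bwd u v a = adj← σ _ _ (subst₂ Adj (sym (fwd-bwd σ u)) (sym (fwd-bwd σ v)) a)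

  compose : Aut⁺ M → Aut⁺ M → Aut⁺ M
  compose σ τ = record
    { fwd = λ v → fwd σ (fwd τ v) ; bwd = λ v → bwd τ (bwd σ v)
    ; bwd-fwd = λ v → trans (cong (bwd τ) (bwd-fwd σ _)) (bwd-fwd τ v)
    ; fwd-bwd = λ v → trans (cong (fwd σ) (fwd-bwd τ _)) (fwd-bwd σ v)
    ; adj→ = λ u v a → adj→ σ _ _ (adj→ τ _ _ a)
    ; adj← = λ u v a → adj← τ _ _ (adj← σ _ _ a)
    ; rot = λ u v a → trans (cong (fwd σ) (rot τ u v a)) (rot σ _ _ (adj→ τ _ _ a))
    }

  conjugate : Aut⁺ M → Aut⁺ M → Aut⁺ M
  conjugate g h = compose (inverse g) (compose h g)

  -- H ⊴ G: a conjugate of a part-preserving automorphism is part-preserving,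
  -- since automorphisms map non-adjacent (same-part) vertices to same-part ones.
  conjugate-preserving : ∀ g h → PartPreserving h → PartPreserving (conjugate g h)
  conjugate-preserving g h h-pres v with proj₁ (bwd g (fwd h (fwd g v))) ≟ᶠ proj₁ v
  ... | yes same = same
  ... | no  differ = ⊥-elim (adj→ g _ v differ
         (trans (cong proj₁ (fwd-bwd g (fwd h (fwd g v)))) (h-pres (fwd g v))))

open AutGroup

%-+-cancel : ∀ m n r .{{_ : NonZero r}} → (m + n) % r ≡ m % r → r ∣ n
%-+-cancel m n r same-residue =
  ∣m+n∣m⇒∣n {m = m / r * r} (divides ((m + n) / r) quotients) (divides (m / r) refl)
  where
  open ≡-Reasoning
  quotients : m / r * r + n ≡ (m + n) / r * r
  quotients = +-cancelˡ-≡ (m % r) _ _ (begin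
    m % r + (m / r * r + n)     ≡⟨ sym (+-assoc (m % r) _ n) ⟩
    (m % r + m / r * r) + n     ≡⟨ cong (_+ n) (sym (m≡m%n+[m/n]*n m r)) ⟩
    m + n                       ≡⟨ m≡m%n+[m/n]*n (m + n) r ⟩
    (m + n) % r + (m + n) / r * r ≡⟨ cong (_+ (m + n) / r * r) same-residue ⟩
    m % r + (m + n) / r * r     ∎)

exponent-divisible : ∀ i i' d k .{{_ : NonZero d}} .{{_ : NonZero (d * k)}} →
                     (i + i') % (d * k) ≡ (i' + (1 + d) * i) % (d * k) → k ∣ i
exponent-divisible i i' d k congruent =
  *-cancelˡ-∣ d (%-+-cancel (i + i') (d * i) (d * k) (sym (trans congruent (cong (_% (d * k)) rearrange))))
  where
  open ≡-Reasoning
  rearrange : i' + (1 + d) * i ≡ (i + i') + d * i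
  rearrange = begin
    i' + (i + d * i)   ≡⟨ sym (+-assoc i' i _) ⟩
    (i' + i) + d * i   ≡⟨ cong (_+ d * i) (+-comm i' i) ⟩
    (i + i') + d * i   ∎

module Normality {n m' : ℕ} (M : Embedding n m') (x z : Aut⁺ M) (d k : ℕ)
                 .{{_ : NonZero d}} .{{_ : NonZero (d * k)}}
                 (pres : HasPresentation M (d * k) (1 + d) x z) where

  r q : ℕ
  r = d * k
  q = 1 + d

  X Z : Vtx n m' → Vtx n m'
  X = fwd x
  Z = fwd z

  N : (Vtx n m' → Vtx n m') → Set
  N = ⟨ iter X k , Z ⟩

  x-pres : PartPreserving x
  x-pres = proj₁ pres

  z-pres : PartPreserving z
  z-pres = proj₁ (proj₂ pres)

  xʳ≗id : ∀ v → iter X r v ≡ v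
  xʳ≗id = proj₁ (proj₂ (proj₂ pres))

  zʳ≗id : ∀ v → iter Z r v ≡ v
  zʳ≗id = proj₁ (proj₂ (proj₂ (proj₂ pres)))

  z^x≗zᑫ : ∀ v → bwd x (Z (X v)) ≡ iter Z q v
  z^x≗zᑫ = proj₁ (proj₂ (proj₂ (proj₂ (proj₂ pres))))

  normal-form : ∀ h → PartPreserving h →
                ∃[ i ] ∃[ j ] (i < r × j < r × (∀ v → fwd h v ≡ iter X i (iter Z j v)))
  normal-form = proj₁ (proj₂ (proj₂ (proj₂ (proj₂ (proj₂ pres)))))

  nf-unique : ∀ i j i' j' → i < r → j < r → i' < r → j' < r →
              (∀ v → iter X i (iter Z j v) ≡ iter X i' (iter Z j' v)) → (i ≡ i') × (j ≡ j')
  nf-unique = proj₂ (proj₂ (proj₂ (proj₂ (proj₂ (proj₂ pres)))))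

  zx≗xzᑫ : ∀ v → Z (X v) ≡ X (iter Z q v)
  zx≗xzᑫ v = trans (sym (fwd-bwd x _)) (cong X (z^x≗zᑫ v))

  open Metacyclic X Z q zx≗xzᑫ

  x-exponent-unique : ∀ i j i' j' → (∀ v → nf i j v ≡ nf i' j' v) → i % r ≡ i' % r
  x-exponent-unique i j i' j' same = proj₁ (nf-unique _ _ _ _
      (m%n<n i r) (m%n<n j r) (m%n<n i' r) (m%n<n j' r)
      (λ v → trans (sym (reduce i j v)) (trans (same v) (reduce i' j' v))))
    where
    reduce : ∀ a b v → nf a b v ≡ nf (a % r) (b % r) v
    reduce a b v = trans (iter-mod X r xʳ≗id a _) (cong (iter X (a % r)) (iter-mod Z r zʳ≗id b v))

  nf-in-N : ∀ c j → N (nf (c * k) j)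
  nf-in-N c j = ext (mul (pow-mem genˡ c) (pow-mem genʳ j)) (λ v → sym (iter-* X k c (iter Z j v)))

  module Conjugates (g : Aut⁺ M) where

    xᵍ zᵍ : Vtx n m' → Vtx n m'
    xᵍ = fwd (conjugate g x)
    zᵍ = fwd (conjugate g z)

    xᵏ-conj-in-N : N (λ v → bwd g (iter X k (fwd g v)))
    xᵏ-conj-in-N with normal-form (conjugate g x) (conjugate-preserving g x x-pres)
    ... | i' , j' , _ , _ , xᵍ≗nf with nf-pow i' j' k
    ... | m , pow≗nf = ext (nf-in-N i' m) λ v → sym (begin
        bwd g (iter X k (fwd g v)) ≡⟨ iter-conj (fwd g) (bwd g) X (bwd-fwd g) (fwd-bwd g) k v ⟩
        iter xᵍ k v                ≡⟨ iter-cong xᵍ≗nf k v ⟩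
        iter (nf i' j') k v        ≡⟨ pow≗nf v ⟩
        nf (k * i') m v            ≡⟨ cong (λ t → nf t m v) (*-comm k i') ⟩
        nf (i' * k) m v            ∎)
      where open ≡-Reasoning

    conj-relation : ∀ v → zᵍ (xᵍ v) ≡ xᵍ (iter zᵍ q v)
    conj-relation v = begin
      bwd g (Z (fwd g (bwd g (X (fwd g v))))) ≡⟨ cong (λ w → bwd g (Z w)) (fwd-bwd g _) ⟩
      bwd g (Z (X (fwd g v)))                 ≡⟨ cong (bwd g) (zx≗xzᑫ _) ⟩
      bwd g (X (iter Z q (fwd g v)))          ≡⟨ cong (λ w → bwd g (X w)) (sym (fwd-bwd g _)) ⟩
      xᵍ (bwd g (iter Z q (fwd g v)))
        ≡⟨ cong xᵍ (iter-conj (fwd g) (bwd g) Z (bwd-fwd g) (fwd-bwd g) q v) ⟩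
      xᵍ (iter zᵍ q v)                        ∎
      where open ≡-Reasoning

    -- Comparing x-exponents on both sides of conj-relation, written in normal
    -- form: k divides the x-exponent of z^g.
    k∣x-exponent : ∀ i j i' j' → (∀ v → zᵍ v ≡ nf i j v) → (∀ v → xᵍ v ≡ nf i' j' v) →
                   k ∣ i
    k∣x-exponent i j i' j' zᵍ≗nf xᵍ≗nf with nf-pow i j q
    ... | m , pow≗nf =
      exponent-divisible i i' d k (x-exponent-unique (i + i') s (i' + q * i) t both-sides)
      where
      open ≡-Reasoning
      s t : ℕ
      s = j * q ^ i' + j'
      t = j' * q ^ (q * i) + m
      both-sides : ∀ v → nf (i + i') s v ≡ nf (i' + q * i) t v
      both-sides v = begin
        nf (i + i') s v            ≡⟨ sym (nf-mul i j i' j' v) ⟩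
        nf i j (nf i' j' v)        ≡⟨ sym (trans (cong zᵍ (xᵍ≗nf v)) (zᵍ≗nf _)) ⟩
        zᵍ (xᵍ v)                  ≡⟨ conj-relation v ⟩
        xᵍ (iter zᵍ q v)           ≡⟨ xᵍ≗nf _ ⟩
        nf i' j' (iter zᵍ q v)     ≡⟨ cong (nf i' j') (iter-cong zᵍ≗nf q v) ⟩
        nf i' j' (iter (nf i j) q v) ≡⟨ cong (nf i' j') (pow≗nf v) ⟩
        nf i' j' (nf (q * i) m v)  ≡⟨ nf-mul i' j' (q * i) m v ⟩
        nf (i' + q * i) t v        ∎

    z-conj-in-N : N zᵍ
    z-conj-in-N with normal-form (conjugate g z) (conjugate-preserving g z z-pres)
                   | normal-form (conjugate g x) (conjugate-preserving g x x-pres)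
    ... | i , j , _ , _ , zᵍ≗nf | i' , j' , _ , _ , xᵍ≗nf
        with k∣x-exponent i j i' j' zᵍ≗nf xᵍ≗nf
    ... | divides c i≡ck = ext (nf-in-N c j) λ v →
      trans (cong (λ t → nf t j v) (sym i≡ck)) (sym (zᵍ≗nf v))

  normal : NormalIn M (iter X k) Z
  normal g f f∈N =
    conj-closed (fwd g) (bwd g) (bwd-fwd g) (fwd-bwd g) xᵏ-conj-in-N z-conj-in-N f∈N
    where open Conjugates g

lemma3p4 : ∀ (p e f : ℕ) → Prime p → p ≢ 2 → 1 ≤ e → 1 ≤ f → f ≤ e →
           (M : Embedding p (p ^ e)) → OrientablyRegular M →
           (x z : Aut⁺ M) → HasPresentation M (p ^ e) (1 + p ^ f) x z →
           NormalIn M (iter (fwd x) (p ^ (e ∸ f))) (fwd z)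
lemma3p4 p e f p-prime _ _ _ f≤e M _ x z pres =
  Normality.normal M x z (p ^ f) (p ^ (e ∸ f))
    (subst (λ r → HasPresentation M r (1 + p ^ f) x z) pᵉ≡pᶠpᵉ⁻ᶠ pres)
  where
  instance
    p≢0 : NonZero p
    p≢0 = prime⇒nonZero p-prime
    pᶠ≢0 : NonZero (p ^ f)
    pᶠ≢0 = m^n≢0 p f
    pᶠpᵉ⁻ᶠ≢0 : NonZero (p ^ f * p ^ (e ∸ f))
    pᶠpᵉ⁻ᶠ≢0 = m*n≢0 (p ^ f) (p ^ (e ∸ f)) {{pᶠ≢0}} {{m^n≢0 p (e ∸ f)}}
  pᵉ≡pᶠpᵉ⁻ᶠ : p ^ e ≡ p ^ f * p ^ (e ∸ f)
  pᵉ≡pᶠpᵉ⁻ᶠ = trans (cong (p ^_) (sym (m+[n∸m]≡n f≤e))) (^-distribˡ-+-* p f (e ∸ f))
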